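{- Let $\mathcal{T}$ be a $\Sigma_1$-theory. If $\mathcal{T}$ is smooth and has the finite model property, then its natural density $\mu(\mathcal{T})$ is well-defined and equal to $1$.
   Context: $\Sigma_1$ is the one-sorted first-order signature with no function or predicate symbols other than equality. Interpretations have non-empty domains and assign values to all variables; a theory is the class of all interpretations satisfying a given set of sentences. $\mathrm{Spec}(\mathcal{T})$ is the set of finite cardinalities of domains of $\mathcal{T}$-interpretations, $\mathrm{Spec}_n(\mathcal{T})=\mathrm{Spec}(\mathcal{T})\cap\{1,\dots,n\}$, and $\mu(\mathcal{T})=\lim_{n\to\infty}|\mathrm{Spec}_n(\mathcal{T})|/n$. $\mathcal{T}$ is smooth if for every quantifier-free formula $\phi$, every $\mathcal{T}$-interpretation $\mathcal{A}$ satisfying $\phi$, and every cardinal $\kappa>|\mathrm{dom}(\mathcal{A})|$, there is a $\mathcal{T}$-interpretation satisfying $\phi$ with domain of cardinality $\kappa$. $\mathcal{T}$ has the finite model property if every $\mathcal{T}$-satisfiable quantifier-free formula is satisfied by a $\mathcal{T}$-interpretation with finite domain. -}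

module Defs where

open import Level using (Level)
open import Data.Nat as ℕ using (ℕ; zero; suc; _≟_)
open import Data.Nat.Properties using ()
open import Data.Integer using (+_)
open import Data.Rational as ℚ using (ℚ; 0ℚ; 1ℚ; _-_; ∣_∣; _/_)
open import Data.Fin using (Fin; toℕ)
open import Data.Fin.Subset using (Subset; _∈_)
import Data.Fin.Subset as Sub
open import Data.Product using (Σ; _×_; _,_)
open import Data.Empty using (⊥)
open import Data.Unit using (⊤)
open import Relation.Nullary using (¬_; yes; no)
open import Relation.Binary.PropositionalEquality using (_≡_)
open import Function.Bundles using (_↣_; _↔_; _⇔_)

-- Syntax of first-order logic over the signature Σ₁ (only equality).
-- Variables are natural numbers.

data Formula : Set where
  _≐_  : ℕ → ℕ → Formula
  ⊥f   : Formula
  ¬f_  : Formula → Formula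
  _∧f_ : Formula → Formula → Formula
  _∨f_ : Formula → Formula → Formula
  _⇒f_ : Formula → Formula → Formula
  ∀f   : ℕ → Formula → Formula
  ∃f   : ℕ → Formula → Formula

data Free (x : ℕ) : Formula → Set where
  eqˡ  : ∀ {y} → Free x (x ≐ y)
  eqʳ  : ∀ {y} → Free x (y ≐ x)
  neg  : ∀ {φ} → Free x φ → Free x (¬f φ)
  andˡ : ∀ {φ ψ} → Free x φ → Free x (φ ∧f ψ)
  andʳ : ∀ {φ ψ} → Free x ψ → Free x (φ ∧f ψ)
  orˡ  : ∀ {φ ψ} → Free x φ → Free x (φ ∨f ψ)
  orʳ  : ∀ {φ ψ} → Free x ψ → Free x (φ ∨f ψ)
  impˡ : ∀ {φ ψ} → Free x φ → Free x (φ ⇒f ψ)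
  impʳ : ∀ {φ ψ} → Free x ψ → Free x (φ ⇒f ψ)
  all  : ∀ {y φ} → ¬ (x ≡ y) → Free x φ → Free x (∀f y φ)
  ex   : ∀ {y φ} → ¬ (x ≡ y) → Free x φ → Free x (∃f y φ)

Sentence : Formula → Set
Sentence φ = ∀ x → ¬ Free x φ

QF : Formula → Set
QF (x ≐ y)  = ⊤
QF ⊥f       = ⊤
QF (¬f φ)   = QF φ
QF (φ ∧f ψ) = QF φ × QF ψ
QF (φ ∨f ψ) = QF φ × QF ψ
QF (φ ⇒f ψ) = QF φ × QF ψ
QF (∀f _ _) = ⊥
QF (∃f _ _) = ⊥

-- Satisfaction is classical Tarskian truth,
-- rendered in the constructive metatheory via the Gödel–Gentzen
-- negative translation (atoms, ∨, ∃ are double-negated).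

record Interp : Set₁ where
  field
    Dom    : Set
    point  : Dom
    assign : ℕ → Dom
open Interp public

update : {D : Set} → (ℕ → D) → ℕ → D → ℕ → D
update s x d y with y ≟ x
... | yes _ = d
... | no  _ = s y

Sat' : (D : Set) → (ℕ → D) → Formula → Set
Sat' D s (x ≐ y)  = ¬ ¬ (s x ≡ s y)
Sat' D s ⊥f       = ⊥
Sat' D s (¬f φ)   = ¬ Sat' D s φ
Sat' D s (φ ∧f ψ) = Sat' D s φ × Sat' D s ψ
Sat' D s (φ ∨f ψ) = ¬ (¬ Sat' D s φ × ¬ Sat' D s ψ)
Sat' D s (φ ⇒f ψ) = Sat' D s φ → Sat' D s ψ
Sat' D s (∀f x φ) = (d : D) → Sat' D (update s x d) φ
Sat' D s (∃f x φ) = ¬ ((d : D) → ¬ Sat' D (update s x d) φ)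

_⊨_ : Interp → Formula → Set
A ⊨ φ = Sat' (Dom A) (assign A) φ

record Theory : Set₁ where
  field
    Ax        : Formula → Set
    Ax-closed : ∀ φ → Ax φ → Sentence φ
open Theory public

Model : Theory → Set₁
Model T = Σ Interp λ A → ∀ φ → Ax T φ → A ⊨ φ

ModelInterp : (T : Theory) → Model T → Interp
ModelInterp T (A , _) = A

T-Sat : Theory → Formula → Set₁
T-Sat T φ = Σ (Model T) λ M → ModelInterp T M ⊨ φ

-- Smoothness: κ > |dom A| is rendered as a set B into which dom A
-- injects but which does not inject into dom A; "domain of cardinality κ"
-- as a bijection with B.
Smooth : Theory → Set₁
Smooth T =
  ∀ φ → QF φ → (M : Model T) → ModelInterp T M ⊨ φ →
  (B : Set) → (Dom (ModelInterp T M) ↣ B) → ¬ (B ↣ Dom (ModelInterp T M)) →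
  Σ (Model T) λ N → (ModelInterp T N ⊨ φ) × (Dom (ModelInterp T N) ↔ B)

FiniteModelProperty : Theory → Set₁
FiniteModelProperty T =
  ∀ φ → QF φ → T-Sat T φ →
  Σ (Model T) λ M → (ModelInterp T M ⊨ φ) × Σ ℕ λ n → Dom (ModelInterp T M) ↔ Fin n

InSpec : Theory → ℕ → Set₁
InSpec T k = Σ (Model T) λ M → Dom (ModelInterp T M) ↔ Fin k

-- |Spec_n(T)| = c : c is the cardinality of a subset S of {1,…,n}
-- (element i : Fin n standing for i+1) that is exactly Spec(T) ∩ {1,…,n}.
SpecCount : Theory → ℕ → ℕ → Set₁
SpecCount T n c =
  Σ (Subset n) λ S → ((i : Fin n) → (i ∈ S → InSpec T (suc (toℕ i))) ×
                                    (InSpec T (suc (toℕ i)) → i ∈ S))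
                     × Sub.∣ S ∣ ≡ c

DensityIs : Theory → ℚ → Set₁
DensityIs T d =
  (ε : ℚ) → ℚ._<_ 0ℚ ε →
  Σ ℕ λ N → (n : ℕ) → ℕ._≤_ N n → .{{_ : ℕ.NonZero n}} →
  (c : ℕ) → SpecCount T n c → ℚ._<_ ∣ ((+ c) / n) - d ∣ ε

-- Applying the finite model property to the trivially satisfiable formula
-- 0 ≐ 0 gives a model of some finite size m.  Since Fin m embeds into Fin k
-- but not conversely when m < k, smoothness then yields models of every size
-- k > m.  Hence {m+1, …, n} ⊆ Spec_n(T), so n ∸ m ≤ |Spec_n(T)| ≤ n, and
-- |Spec_n(T)|/n is within m/n of 1.

module Submission where

open import Defs
open import Data.Nat as ℕ using (ℕ; zero; suc; _∸_; z≤n; s≤s; NonZero)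
import Data.Nat.Properties as ℕP
open import Data.Integer as ℤ using (+_; +[1+_]; -[1+_])
import Data.Integer.Properties as ℤP
open import Data.Rational as ℚ using (mkℚ; 0ℚ; 1ℚ; _-_; ∣_∣; _/_; toℚᵘ)
import Data.Rational.Properties as ℚP
open import Data.Rational.Unnormalised as ℚᵘ using (mkℚᵘ; 1ℚᵘ; *≡*; *≤*; *<*)
import Data.Rational.Unnormalised.Properties as ℚᵘP
open import Data.Fin as Fin using (Fin; toℕ; inject≤)
open import Data.Fin.Properties using (inject≤-injective; injective⇒≤)
open import Data.Fin.Subset as Sub using (Subset; _∈_)
open import Data.Fin.Subset.Properties using (drop-there; ∣p∣≤n; ∣p∣≤∣x∷p∣)
open import Data.Vec using (_∷_; []; here)
open import Data.Product using (Σ; _,_; proj₂)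
open import Data.Unit using (tt)
open import Function.Bundles using (_↣_; mk↣; Injection)
open import Function.Properties.Inverse using (↔⇒↣)
open import Function.Construct.Composition using (_↣-∘_)
open import Relation.Nullary using (¬_)
open import Relation.Binary.PropositionalEquality
  using (_≡_; refl; sym; cong; cong₂; subst; subst₂; module ≡-Reasoning)

-- ℚ's _/_ normalises, so estimates are carried out on unnormalised fractions.
toℚᵘ-/ : ∀ i n .{{_ : NonZero n}} → toℚᵘ (i / n) ℚᵘ.≃ i ℚᵘ./ n
toℚᵘ-/ i (suc n) = ℚP.toℚᵘ-fromℚᵘ (mkℚᵘ i n)

∣c/n-1∣ᵘ≃[n∸c]/n : ∀ {c n} .{{_ : NonZero n}} → c ℕ.≤ n →
                   ℚᵘ.∣ + c ℚᵘ./ n ℚᵘ.- 1ℚᵘ ∣ ℚᵘ.≃ + (n ∸ c) ℚᵘ./ n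
∣c/n-1∣ᵘ≃[n∸c]/n {c} {suc n} c≤n =
  *≡* (cong₂ (λ a b → + a ℤ.* + b) distance (cong suc (sym (ℕP.*-identityʳ n))))
  where
  open ≡-Reasoning
  distance : ℤ.∣ + c ℤ.* + 1 ℤ.+ -[1+ 0 ] ℤ.* + suc n ∣ ≡ suc n ∸ c
  distance = begin
    ℤ.∣ + c ℤ.* + 1 ℤ.+ -[1+ 0 ] ℤ.* + suc n ∣
      ≡⟨ cong₂ (λ a b → ℤ.∣ a ℤ.+ b ∣) (ℤP.*-identityʳ (+ c)) (ℤP.-1*i≡-i (+ suc n)) ⟩
    ℤ.∣ + c ℤ.- + suc n ∣  ≡⟨ cong ℤ.∣_∣ (ℤP.m-n≡m⊖n c (suc n)) ⟩
    ℤ.∣ c ℤ.⊖ suc n ∣      ≡⟨ ℤP.∣m⊖n∣≡∣n⊖m∣ c (suc n) ⟩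
    ℤ.∣ suc n ℤ.⊖ c ∣      ≡⟨ cong ℤ.∣_∣ (ℤP.⊖-≥ c≤n) ⟩
    suc n ∸ c              ∎

∣c/n-1∣≡[n∸c]/n : ∀ {c n} .{{_ : NonZero n}} → c ℕ.≤ n → ∣ + c / n - 1ℚ ∣ ≡ + (n ∸ c) / n
∣c/n-1∣≡[n∸c]/n {c} {n} c≤n = ℚP.toℚᵘ-injective (begin-equality
  toℚᵘ ∣ + c / n - 1ℚ ∣                     ≃⟨ ℚP.toℚᵘ-homo-∣-∣ (+ c / n - 1ℚ) ⟩
  ℚᵘ.∣ toℚᵘ (+ c / n - 1ℚ) ∣                ≃⟨ ℚᵘP.∣-∣-cong (ℚP.toℚᵘ-homo-+ (+ c / n) (ℚ.- 1ℚ)) ⟩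
  ℚᵘ.∣ toℚᵘ (+ c / n) ℚᵘ.+ toℚᵘ (ℚ.- 1ℚ) ∣  ≃⟨ ℚᵘP.∣-∣-cong (ℚᵘP.+-cong (toℚᵘ-/ (+ c) n) (ℚP.toℚᵘ-homo‿- 1ℚ)) ⟩
  ℚᵘ.∣ + c ℚᵘ./ n ℚᵘ.- 1ℚᵘ ∣                 ≃⟨ ∣c/n-1∣ᵘ≃[n∸c]/n c≤n ⟩
  + (n ∸ c) ℚᵘ./ n                          ≃⟨ toℚᵘ-/ (+ (n ∸ c)) n ⟨
  toℚᵘ (+ (n ∸ c) / n)                      ∎)
  where open ℚᵘP.≤-Reasoning

/-monoˡ-≤ : ∀ {a b} n .{{_ : NonZero n}} → a ℕ.≤ b → + a / n ℚ.≤ + b / n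
/-monoˡ-≤ {a} {b} n@(suc _) a≤b = ℚP.toℚᵘ-cancel-≤ (begin
  toℚᵘ (+ a / n)   ≃⟨ toℚᵘ-/ (+ a) n ⟩
  + a ℚᵘ./ n       ≤⟨ *≤* (ℤP.*-monoʳ-≤-nonNeg (+ n) (ℤ.+≤+ a≤b)) ⟩
  + b ℚᵘ./ n       ≃⟨ toℚᵘ-/ (+ b) n ⟨
  toℚᵘ (+ b / n)   ∎)
  where open ℚᵘP.≤-Reasoning

m/n→0 : ∀ m ε → 0ℚ ℚ.< ε → Σ ℕ λ N → ∀ n → N ℕ.≤ n → .{{_ : NonZero n}} → + m / n ℚ.< ε
m/n→0 m ε@(mkℚ +[1+ a ] b _) _ = suc (m ℕ.* suc b) , m/n<ε
  where
  m/n<ε : ∀ n → suc (m ℕ.* suc b) ℕ.≤ n → .{{_ : NonZero n}} → + m / n ℚ.< ε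
  m/n<ε n@(suc _) N≤n = ℚP.toℚᵘ-cancel-< (begin-strict
    toℚᵘ (+ m / n)   ≃⟨ toℚᵘ-/ (+ m) n ⟩
    + m ℚᵘ./ n       <⟨ *<* (subst₂ ℤ._<_ (ℤP.pos-* m (suc b)) (ℤP.pos-* (suc a) n) (ℤ.+<+ mb<an)) ⟩
    toℚᵘ ε           ∎)
    where
    open ℚᵘP.≤-Reasoning
    mb<an : m ℕ.* suc b ℕ.< suc a ℕ.* n
    mb<an = ℕP.<-≤-trans N≤n (ℕP.m≤n*m n (suc a))
m/n→0 m (mkℚ (+ zero) _ _) (ℚ.*<* (ℤ.+<+ ()))
m/n→0 m (mkℚ -[1+ _ ] _ _) (ℚ.*<* ())

c/n→1 : ∀ m ε → 0ℚ ℚ.< ε → Σ ℕ λ N → ∀ n → N ℕ.≤ n → .{{_ : NonZero n}} →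
        ∀ c → c ℕ.≤ n → n ∸ m ℕ.≤ c → ∣ + c / n - 1ℚ ∣ ℚ.< ε
c/n→1 m ε 0<ε with m/n→0 m ε 0<ε
... | N , m/n<ε = N , λ n N≤n c c≤n n∸m≤c → begin-strict
  ∣ + c / n - 1ℚ ∣  ≡⟨ ∣c/n-1∣≡[n∸c]/n c≤n ⟩
  + (n ∸ c) / n     ≤⟨ /-monoˡ-≤ n (n∸c≤m n c n∸m≤c) ⟩
  + m / n           <⟨ m/n<ε n N≤n ⟩
  ε                 ∎
  where
  open ℚP.≤-Reasoning
  n∸c≤m : ∀ n c → n ∸ m ℕ.≤ c → n ∸ c ℕ.≤ m
  n∸c≤m n c n∸m≤c = ℕP.m≤n+o⇒m∸n≤o n c (ℕP.≤-trans (ℕP.m≤n+m∸n n m)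
    (ℕP.≤-trans (ℕP.+-monoʳ-≤ m n∸m≤c) (ℕP.≤-reflexive (ℕP.+-comm m c))))

n∸m≤∣p∣ : ∀ {n} m (p : Subset n) → (∀ i → m ℕ.≤ toℕ i → i ∈ p) → n ∸ m ℕ.≤ Sub.∣ p ∣
n∸m≤∣p∣ {zero}  zero    []      _ = z≤n
n∸m≤∣p∣ {zero}  (suc m) []      _ = z≤n
n∸m≤∣p∣ {suc n} zero    (x ∷ p) ≥m⊆p with ≥m⊆p Fin.zero z≤n
... | here = s≤s (n∸m≤∣p∣ zero p (λ i _ → drop-there (≥m⊆p (Fin.suc i) z≤n)))
n∸m≤∣p∣ {suc n} (suc m) (x ∷ p) ≥m⊆p = ℕP.≤-trans
  (n∸m≤∣p∣ m p (λ i m≤i → drop-there (≥m⊆p (Fin.suc i) (s≤s m≤i))))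
  (∣p∣≤∣x∷p∣ x p)

cofinite-spectrum⇒density-1 : ∀ T m → (∀ k → m ℕ.< k → InSpec T k) → DensityIs T 1ℚ
cofinite-spectrum⇒density-1 T m cofinite ε 0<ε with c/n→1 m ε 0<ε
... | N , close = N , λ n N≤n c (S , S≡Spec , ∣S∣≡c) →
  close n N≤n c (subst (ℕ._≤ n) ∣S∣≡c (∣p∣≤n S))
    (subst (n ∸ m ℕ.≤_) ∣S∣≡c (n∸m≤∣p∣ m S λ i m≤i →
      proj₂ (S≡Spec i) (cofinite (suc (toℕ i)) (s≤s m≤i))))

tautology : Formula
tautology = 0 ≐ 0

⊨-tautology : ∀ A → A ⊨ tautology
⊨-tautology A 0≢0 = 0≢0 refl

Fin-↣ : ∀ {m n} → m ℕ.≤ n → Fin m ↣ Fin n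
Fin-↣ m≤n = mk↣ {to = λ i → inject≤ i m≤n} λ {i} {j} → inject≤-injective m≤n m≤n i j

↣⇒≤ : ∀ {m n} → Fin m ↣ Fin n → m ℕ.≤ n
↣⇒≤ m↣n = injective⇒≤ (Injection.injective m↣n)

fmp⇒InSpec : ∀ T → Model T → FiniteModelProperty T → Σ ℕ (InSpec T)
fmp⇒InSpec T M fmp with fmp tautology tt (M , ⊨-tautology (ModelInterp T M))
... | N , _ , m , N≅m = m , N , N≅m

smooth⇒InSpec-upward : ∀ T → Smooth T → ∀ {m k} → m ℕ.< k → InSpec T m → InSpec T k
smooth⇒InSpec-upward T smooth {m} {k} m<k (M , M≅m) =
  let N , _ , N≅k = smooth tautology tt M (⊨-tautology (ModelInterp T M)) (Fin k) M↣k k↣̸M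
  in N , N≅k
  where
  M↣k : Dom (ModelInterp T M) ↣ Fin k
  M↣k = Fin-↣ (ℕP.<⇒≤ m<k) ↣-∘ ↔⇒↣ M≅m
  k↣̸M : ¬ (Fin k ↣ Dom (ModelInterp T M))
  k↣̸M k↣M = ℕP.<⇒≱ m<k (↣⇒≤ (↔⇒↣ M≅m ↣-∘ k↣M))

theorem3 : (T : Theory) → Model T → Smooth T → FiniteModelProperty T →
    DensityIs T 1ℚ
theorem3 T M smooth fmp with fmp⇒InSpec T M fmp
... | m , m∈Spec = cofinite-spectrum⇒density-1 T m
  (λ k m<k → smooth⇒InSpec-upward T smooth m<k m∈Spec)
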